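{- Let $G=(V,E)$ be a graph, $p\colon V\to\mathbb{Z}_{>0}$, $\prec$ a total order on $V$, and $U\subseteq V$. Let $S_U=\{v\in U:\bar N^-(v)\cap U=\emptyset\}$. The following inequality is valid for $\mathcal P(G,p)$: \[\sum_{v\in U\setminus S_U}\ \sum_{u\in(\bar N^-(v)\setminus U)\cup\{v\}}x_{uv}\ \ge\ \chi(G[U])-|S_U|.\]
   Context: $\chi(H)$ is the chromatic number of $H$. $n=|V|$, $\bar E$ is the edge set of the complement of $G$ and $\bar e=|\bar E|$. Let $\bar N^-(w)=\{u\in V: u\prec w,\ \{u,w\}\notin E\}$, $\bar N^+(w)=\{u\in V: w\prec u,\ \{u,w\}\notin E\}$, $\bar N^-[w]=\bar N^-(w)\cup\{w\}$, $S=\{w:\bar N^-(w)=\emptyset\}$, $T=\{w:\bar N^+(w)=\emptyset\}$. Variables: $x_{uw}$ for $w\in V$, $u\in\bar N^-(w)$, and $x_{ww}$ for $w\in V\setminus S$ (so $n+\bar e-|S|$ variables), plus a real variable $y$. $\mathcal K(w)$ is the collection of subsets of $\bar N^+(w)$ inducing a clique of size 2 in $G$ or a maximal clique of size 1 in $G[\bar N^+(w)]$. Constraints: (C1) $\sum_{u\in\bar N^-[w]}x_{uw}\ge1$ for $w\in V\setminus S$; (C2) $\sum_{u\in K}x_{wu}\le x_{ww}$ for $w\in(V\setminus T)\setminus S$, $K\in\mathcal K(w)$; (C3) $\sum_{u\in K}x_{wu}\le 1$ for $w\in(V\setminus T)\cap S$, $K\in\mathcal K(w)$; (C4) $p(w)x_{ww}+\sum_{u\in\bar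 N^+(w)}p(u)x_{wu}\le y$ for $w\in V\setminus S$; (C5) $p(w)+\sum_{u\in\bar N^+(w)}p(u)x_{wu}\le y$ for $w\in S$. $\mathcal P(G,p)=\operatorname{conv}\{(y,x)\in\mathbb{R}_{\ge0}\times\{0,1\}^{n+\bar e-|S|}:(y,x)\text{ satisfies (C1)–(C5)}\}$. -}

module Defs where

open import Data.Nat using (ℕ; zero; suc; _+_; _*_; _≤_; _<_)
open import Data.Bool using (Bool; true; false; if_then_else_; _∧_; _∨_; not)
open import Data.Fin using (Fin; zero; suc)
open import Data.Product using (_×_; Σ; ∃)
open import Data.Sum using (_⊎_)
open import Data.Empty using (⊥)
open import Data.Integer using (+_)
open import Data.Rational using (ℚ; _/_) renaming (_≤_ to _≤ℚ_)
open import Relation.Binary.PropositionalEquality using (_≡_; _≢_)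
open import Function using (_∘_)
open import Data.Fin using (_≟_)
open import Relation.Nullary.Decidable using (isYes)

anyFin : ∀ {n} → (Fin n → Bool) → Bool
anyFin {zero}  P = false
anyFin {suc n} P = P zero ∨ anyFin (P ∘ suc)

-- Vertex set V = Fin n.  Subsets of V are Boolean predicates Fin n → Bool.

record Graph (n : ℕ) : Set where
  field
    adj    : Fin n → Fin n → Bool
    sym    : ∀ u v → adj u v ≡ adj v u
    irrefl : ∀ v → adj v v ≡ false
open Graph public

record TotalOrder (n : ℕ) : Set where
  field
    lt      : Fin n → Fin n → Bool
    irrefl  : ∀ v → lt v v ≡ false
    trans   : ∀ u v w → lt u v ≡ true → lt v w ≡ true → lt u w ≡ true
    connex  : ∀ u v → u ≢ v → (lt u v ≡ true) ⊎ (lt v u ≡ true)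
open TotalOrder public

sumFin : ∀ {n} → (Fin n → ℕ) → ℕ
sumFin {zero}  f = 0
sumFin {suc n} f = f zero + sumFin (f ∘ suc)

sumOver : ∀ {n} → (Fin n → Bool) → (Fin n → ℕ) → ℕ
sumOver P f = sumFin (λ i → if P i then f i else 0)

card : ∀ {n} → (Fin n → Bool) → ℕ
card P = sumOver P (λ _ → 1)

Empty : ∀ {n} → (Fin n → Bool) → Set
Empty P = ∀ i → P i ≡ false

b2n : Bool → ℕ
b2n true  = 1
b2n false = 0

ℕ→ℚ : ℕ → ℚ
ℕ→ℚ m = (+ m) / 1

module _ {n : ℕ} (G : Graph n) (ord : TotalOrder n) where

  Nm : Fin n → Fin n → Bool
  Nm w u = lt ord u w ∧ not (adj G u w)

  Np : Fin n → Fin n → Bool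
  Np w u = lt ord w u ∧ not (adj G u w)

  InS : Fin n → Set
  InS w = Empty (Nm w)

  InT : Fin n → Set
  InT w = Empty (Np w)

  -- K ∈ 𝒦(w): K ⊆ N̄⁺(w) and either K induces a clique of size 2 in G,
  -- or K = {u} is a maximal clique of size 1 in G[N̄⁺(w)]
  -- (i.e. u has no neighbour in N̄⁺(w)).
  InCalK : Fin n → (Fin n → Bool) → Set
  InCalK w K =
    (∀ u → K u ≡ true → Np w u ≡ true) ×
    ( (card K ≡ 2 × (∀ u v → K u ≡ true → K v ≡ true → u ≢ v → adj G u v ≡ true))
    ⊎ (card K ≡ 1 × (∀ u v → K u ≡ true → Np w v ≡ true → adj G u v ≡ false)) )

  -- The point (y, x) with y ∈ ℚ, x binary, satisfies (C1)–(C5).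
  -- x u w is the value of the variable x_{uw}; only the entries with
  -- u ∈ N̄⁻(w), or u = w ∉ S, are variables; other entries are unused.
  Feasible : (p : Fin n → ℕ) → ℚ → (Fin n → Fin n → Bool) → Set
  Feasible p y x =
    (∀ w → ¬S w → 1 ≤ b2n (x w w) + sumOver (Nm w) (λ u → b2n (x u w))) ×
    (∀ w → ¬T w → ¬S w → ∀ K → InCalK w K →
        sumOver K (λ u → b2n (x w u)) ≤ b2n (x w w)) ×
    (∀ w → ¬T w → InS w → ∀ K → InCalK w K →
        sumOver K (λ u → b2n (x w u)) ≤ 1) ×
    (∀ w → ¬S w →
        ℕ→ℚ (p w * b2n (x w w) + sumOver (Np w) (λ u → p u * b2n (x w u))) ≤ℚ y) ×
    (∀ w → InS w →
        ℕ→ℚ (p w + sumOver (Np w) (λ u → p u * b2n (x w u))) ≤ℚ y)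
    where
      ¬S : Fin n → Set
      ¬S w = InS w → ⊥
      ¬T : Fin n → Set
      ¬T w = InT w → ⊥

Colorable : ∀ {n} → Graph n → (Fin n → Bool) → ℕ → Set
Colorable {n} G U k =
  Σ ((v : Fin n) → U v ≡ true → ℕ) λ c →
    (∀ v (hv : U v ≡ true) → c v hv < k) ×
    (∀ u v (hu : U u ≡ true) (hv : U v ≡ true) → adj G u v ≡ true → c u hu ≢ c v hv)

IsChromaticNumber : ∀ {n} → Graph n → (Fin n → Bool) → ℕ → Set
IsChromaticNumber G U k = Colorable G U k × (∀ j → Colorable G U j → k ≤ j)

module _ {n : ℕ} (G : Graph n) (ord : TotalOrder n) (U : Fin n → Bool) where

  SU : Fin n → Bool
  SU v = U v ∧ not (anyFin (λ u → Nm G ord v u ∧ U u))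

  lhs : (Fin n → Fin n → Bool) → ℕ
  lhs x = sumOver (λ v → U v ∧ not (SU v))
            (λ v → sumOver (λ u → (Nm G ord v u ∧ not (U u)) ∨ isYes (u ≟ v))
                           (λ u → b2n (x u v)))

{-# OPTIONS --safe #-}
module Submission where

-- Call v ∈ U a leader if v ∈ S_U or v has a positive term on the left-hand side;
-- leaders are at most lhs + |S_U| in number.  A vertex v ∈ U that is not a leader has
-- x_vv = 0 and is not in S, so (C1) yields r ∈ N̄⁻(v) ∩ U with x_rv = 1.  Such r is a
-- leader: if r ∉ S_U then r ∉ S, and (C2) for a K ∈ 𝒦(r) containing v forces x_rr = 1.
-- Colouring each v by its leader (itself, or such an r) is proper: r is not adjacent to
-- the vertices it covers, and two adjacent vertices covered by r would form a clique
-- K ∈ 𝒦(r) with Σ_{u∈K} x_ru = 2, against (C2) or (C3).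

open import Defs hiding (sym; trans)
open import Data.Nat using (ℕ; zero; suc; _+_; _≤_; _<_; _<ᵇ_; z≤n; s≤s)
open import Data.Nat.Properties
  using (≤-refl; ≤-trans; ≤-reflexive; <-irrefl; +-mono-≤; +-monoʳ-<; +-cancelˡ-≡;
         +-identityʳ; m≤m+n; m≤n+m; n≤0⇒n≡0; +-commutativeSemigroup; module ≤-Reasoning)
open import Algebra.Properties.CommutativeSemigroup +-commutativeSemigroup using (interchange)
open import Data.Bool using (Bool; true; false; _∧_; _∨_; not; if_then_else_)
open import Data.Bool.Properties using (not-¬; ∨-zeroʳ)
open import Data.Fin using (Fin; zero; suc; _≟_)
open import Data.Fin.Properties using (suc-injective)
open import Data.Product using (∃; _×_; _,_; proj₁; proj₂)
open import Data.Sum using (_⊎_; inj₁; inj₂)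
open import Data.Empty using (⊥)
open import Relation.Nullary using (¬_; Dec; yes; no; contradiction)
open import Relation.Nullary.Decidable using (isYes)
open import Relation.Binary.PropositionalEquality
  using (_≡_; _≢_; refl; sym; trans; cong; cong₂; subst; module ≡-Reasoning)
open import Data.Rational using (ℚ; 0ℚ) renaming (_≤_ to _≤ℚ_)
open import Function using (_∘_)

sumFin-mono : ∀ {n} {f g : Fin n → ℕ} → (∀ i → f i ≤ g i) → sumFin f ≤ sumFin g
sumFin-mono {zero}  f≤g = z≤n
sumFin-mono {suc n} f≤g = +-mono-≤ (f≤g zero) (sumFin-mono (f≤g ∘ suc))

sumFin-cong : ∀ {n} {f g : Fin n → ℕ} → (∀ i → f i ≡ g i) → sumFin f ≡ sumFin g
sumFin-cong {zero}  f≡g = refl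
sumFin-cong {suc n} f≡g = cong₂ _+_ (f≡g zero) (sumFin-cong (f≡g ∘ suc))

sumFin-+ : ∀ {n} (f g : Fin n → ℕ) → sumFin (λ i → f i + g i) ≡ sumFin f + sumFin g
sumFin-+ {zero}  f g = refl
sumFin-+ {suc n} f g =
  trans (cong (f zero + g zero +_) (sumFin-+ (f ∘ suc) (g ∘ suc)))
        (interchange (f zero) (g zero) (sumFin (f ∘ suc)) (sumFin (g ∘ suc)))

sumFin-zero : ∀ {n} (f : Fin n → ℕ) → (∀ i → f i ≡ 0) → sumFin f ≡ 0
sumFin-zero {zero}  f f≡0 = refl
sumFin-zero {suc n} f f≡0 = cong₂ _+_ (f≡0 zero) (sumFin-zero (f ∘ suc) (f≡0 ∘ suc))

sumFin-single : ∀ {n} (f : Fin n → ℕ) a → (∀ i → i ≢ a → f i ≡ 0) → sumFin f ≡ f a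
sumFin-single f zero    f≡0 =
  trans (cong (f zero +_) (sumFin-zero (f ∘ suc) (λ i → f≡0 (suc i) λ ())))
        (+-identityʳ (f zero))
sumFin-single f (suc a) f≡0 =
  cong₂ _+_ (f≡0 zero λ ())
            (sumFin-single (f ∘ suc) a (λ i i≢a → f≡0 (suc i) (i≢a ∘ suc-injective)))

term≤sumFin : ∀ {n} (f : Fin n → ℕ) i → f i ≤ sumFin f
term≤sumFin f zero    = m≤m+n (f zero) _
term≤sumFin f (suc i) = ≤-trans (term≤sumFin (f ∘ suc) i) (m≤n+m _ (f zero))

0<sumFin⇒∃ : ∀ {n} (f : Fin n → ℕ) → 0 < sumFin f → ∃ λ i → 0 < f i
0<sumFin⇒∃ {suc n} f 0<Σ with f zero in f0
... | suc _ = zero , subst (0 <_) (sym f0) (s≤s z≤n)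
... | zero with 0<sumFin⇒∃ (f ∘ suc) 0<Σ
...   | i , 0<fi = suc i , 0<fi

member≤sumOver : ∀ {n} (P : Fin n → Bool) (f : Fin n → ℕ) {i} → P i ≡ true → f i ≤ sumOver P f
member≤sumOver P f {i} Pi =
  subst (λ b → (if b then f i else 0) ≤ sumOver P f) Pi
        (term≤sumFin (λ j → if P j then f j else 0) i)

0<sumOver⇒∃ : ∀ {n} (P : Fin n → Bool) (f : Fin n → ℕ) → 0 < sumOver P f →
  ∃ λ i → P i ≡ true × 0 < f i
0<sumOver⇒∃ P f 0<Σ with 0<sumFin⇒∃ _ 0<Σ
... | i , 0<fi with P i in Pi
...   | true = i , Pi , 0<fi

∧-≡-true : ∀ {a b} → a ∧ b ≡ true → a ≡ true × b ≡ true
∧-≡-true {true} {true} refl = refl , refl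

b2n≤1 : ∀ b → b2n b ≤ 1
b2n≤1 true  = ≤-refl
b2n≤1 false = z≤n

0<b2n⇒≡true : ∀ {b} → 0 < b2n b → b ≡ true
0<b2n⇒≡true {true} _ = refl

singleton : ∀ {n} → Fin n → Fin n → Bool
singleton a i = isYes (i ≟ a)

pair : ∀ {n} → Fin n → Fin n → Fin n → Bool
pair a b i = singleton a i ∨ singleton b i

singleton-refl : ∀ {n} (a : Fin n) → singleton a a ≡ true
singleton-refl a with a ≟ a
... | yes _  = refl
... | no a≢a = contradiction refl a≢a

singleton⇒≡ : ∀ {n} {a i : Fin n} → singleton a i ≡ true → i ≡ a
singleton⇒≡ {a = a} {i} i∈a with i ≟ a
... | yes i≡a = i≡a

singleton-≢ : ∀ {n} {a i : Fin n} → i ≢ a → singleton a i ≡ false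
singleton-≢ {a = a} {i} i≢a with i ≟ a
... | yes i≡a = contradiction i≡a i≢a
... | no _    = refl

pair⇒≡⊎≡ : ∀ {n} (a b i : Fin n) → pair a b i ≡ true → i ≡ a ⊎ i ≡ b
pair⇒≡⊎≡ a b i i∈ab with singleton a i in i∈a
... | true  = inj₁ (singleton⇒≡ i∈a)
... | false = inj₂ (singleton⇒≡ i∈ab)

sumOver-singleton : ∀ {n} (a : Fin n) (f : Fin n → ℕ) → sumOver (singleton a) f ≡ f a
sumOver-singleton a f =
  trans (sumFin-single _ a (λ i i≢a → cong (λ b → if b then f i else 0) (singleton-≢ i≢a)))
        (cong (λ b → if b then f a else 0) (singleton-refl a))

sumOver-pair : ∀ {n} {a b : Fin n} → a ≢ b → (f : Fin n → ℕ) →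
  sumOver (pair a b) f ≡ f a + f b
sumOver-pair {a = a} {b} a≢b f = begin
  sumOver (pair a b) f                              ≡⟨ sumFin-cong split ⟩
  sumFin (λ i → f-on a i + f-on b i)                ≡⟨ sumFin-+ (f-on a) (f-on b) ⟩
  sumOver (singleton a) f + sumOver (singleton b) f ≡⟨ cong₂ _+_ (sumOver-singleton a f)
                                                                 (sumOver-singleton b f) ⟩
  f a + f b                                         ∎
  where
  open ≡-Reasoning
  f-on : _ → _ → ℕ
  f-on c i = if singleton c i then f i else 0
  split : ∀ i → (if pair a b i then f i else 0) ≡ f-on a i + f-on b i
  split i with singleton a i in i∈a | singleton b i in i∈b
  ... | true  | true  = contradiction (trans (sym (singleton⇒≡ i∈a)) (singleton⇒≡ i∈b)) a≢b
  ... | true  | false = sym (+-identityʳ (f i))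
  ... | false | _     = refl

anyFin⇒∃ : ∀ {n} (P : Fin n → Bool) → anyFin P ≡ true → ∃ λ i → P i ≡ true
anyFin⇒∃ {suc n} P any with P zero in P0
... | true  = zero , P0
... | false with anyFin⇒∃ (P ∘ suc) any
...   | i , Pi = suc i , Pi

¬anyFin⇒∀ : ∀ {n} (P : Fin n → Bool) → anyFin P ≡ false → ∀ i → P i ≡ false
¬anyFin⇒∀ {suc n} P none i with P zero in P0
¬anyFin⇒∀ {suc n} P none zero    | false = P0
¬anyFin⇒∀ {suc n} P none (suc i) | false = ¬anyFin⇒∀ (P ∘ suc) none i

∀⇒¬anyFin : ∀ {n} (P : Fin n → Bool) → (∀ i → P i ≡ false) → anyFin P ≡ false
∀⇒¬anyFin {zero}  P none = refl
∀⇒¬anyFin {suc n} P none rewrite none zero = ∀⇒¬anyFin (P ∘ suc) (none ∘ suc)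

rank : ∀ {n} → (Fin n → Bool) → Fin n → ℕ
rank A zero    = 0
rank A (suc a) = (if A zero then 1 else 0) + rank (A ∘ suc) a

rank<card : ∀ {n} (A : Fin n → Bool) {a} → A a ≡ true → rank A a < card A
rank<card A {zero}  Aa rewrite Aa = s≤s z≤n
rank<card A {suc a} Aa = +-monoʳ-< (if A zero then 1 else 0) (rank<card (A ∘ suc) Aa)

rank-injective : ∀ {n} (A : Fin n → Bool) {a b} → A a ≡ true → A b ≡ true →
  rank A a ≡ rank A b → a ≡ b
rank-injective A {zero}  {zero}  Aa Ab eq = refl
rank-injective A {zero}  {suc b} Aa Ab eq rewrite Aa with () ← eq
rank-injective A {suc a} {zero}  Aa Ab eq rewrite Ab with () ← eq
rank-injective A {suc a} {suc b} Aa Ab eq =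
  cong suc (rank-injective (A ∘ suc) Aa Ab (+-cancelˡ-≡ (if A zero then 1 else 0) _ _ eq))

colorable-by-representatives : ∀ {n} (G : Graph n) (U A : Fin n → Bool)
  (ρ : ∀ v → U v ≡ true → Fin n) → (∀ v v∈U → A (ρ v v∈U) ≡ true) →
  (∀ u v u∈U v∈U → adj G u v ≡ true → ρ u u∈U ≢ ρ v v∈U) →
  Colorable G U (card A)
colorable-by-representatives G U A ρ ρ∈A ρ-proper =
    (λ v v∈U → rank A (ρ v v∈U))
  , (λ v v∈U → rank<card A (ρ∈A v v∈U))
  , (λ u v u∈U v∈U uv → ρ-proper u v u∈U v∈U uv ∘ rank-injective A (ρ∈A u u∈U) (ρ∈A v v∈U))

module _ {n : ℕ} (G : Graph n) (ord : TotalOrder n) where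

  adjacent⇒≢ : ∀ {u v} → adj G u v ≡ true → u ≢ v
  adjacent⇒≢ {u} uv refl = not-¬ uv (Graph.irrefl G u)

  Np≡Nm : ∀ w u → Np G ord w u ≡ Nm G ord u w
  Np≡Nm w u = cong (λ b → lt ord w u ∧ not b) (Graph.sym G u w)

  Nm⇒nonadjacent : ∀ {v u} → Nm G ord v u ≡ true → adj G u v ≡ false
  Nm⇒nonadjacent {v} {u} u∈N⁻v with lt ord u v | adj G u v
  ... | true | false = refl

  InS? : ∀ w → Dec (InS G ord w)
  InS? w with anyFin (Nm G ord w) in any
  ... | true  = no λ w∈S → let (u , u∈N⁻w) = anyFin⇒∃ (Nm G ord w) any in not-¬ u∈N⁻w (w∈S u)
  ... | false = yes (¬anyFin⇒∀ (Nm G ord w) any)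

  ¬SU⇒¬InS : ∀ (U : Fin n → Bool) {v} → U v ≡ true → SU G ord U v ≡ false → ¬ InS G ord v
  ¬SU⇒¬InS U {v} v∈U v∉SU v∈S =
    not-¬ (cong₂ (λ a b → a ∧ not b) v∈U (∀⇒¬anyFin _ λ u → cong (_∧ U u) (v∈S u))) v∉SU

  pair∈𝒦 : ∀ {w a b} → adj G a b ≡ true → Np G ord w a ≡ true → Np G ord w b ≡ true →
    InCalK G ord w (pair a b)
  pair∈𝒦 {w} {a} {b} ab a∈N⁺w b∈N⁺w =
    (λ u u∈ab → case-pair u∈ab a∈N⁺w b∈N⁺w) ,
    inj₁ (sumOver-pair (adjacent⇒≢ ab) (λ _ → 1) , clique)
    where
    case-pair : ∀ {ℓ} {P : Fin n → Set ℓ} {u} → pair a b u ≡ true → P a → P b → P u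
    case-pair {u = u} u∈ab Pa Pb with pair⇒≡⊎≡ a b u u∈ab
    ... | inj₁ refl = Pa
    ... | inj₂ refl = Pb
    clique : ∀ u v → pair a b u ≡ true → pair a b v ≡ true → u ≢ v → adj G u v ≡ true
    clique u v u∈ab v∈ab u≢v with pair⇒≡⊎≡ a b u u∈ab | pair⇒≡⊎≡ a b v v∈ab
    ... | inj₁ refl | inj₁ refl = contradiction refl u≢v
    ... | inj₁ refl | inj₂ refl = ab
    ... | inj₂ refl | inj₁ refl = trans (Graph.sym G b a) ab
    ... | inj₂ refl | inj₂ refl = contradiction refl u≢v

  ∃𝒦∋ : ∀ {w v} → Np G ord w v ≡ true → ∃ λ K → InCalK G ord w K × K v ≡ true
  ∃𝒦∋ {w} {v} v∈N⁺w with anyFin (λ u → Np G ord w u ∧ adj G v u) in any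
  ... | true  =
    let (u , u∈N⁺w∧vu) = anyFin⇒∃ _ any
        (u∈N⁺w , vu)   = ∧-≡-true u∈N⁺w∧vu
    in pair v u , pair∈𝒦 vu v∈N⁺w u∈N⁺w , cong (_∨ singleton u v) (singleton-refl v)
  ... | false =
    singleton v , (⊆N⁺w , inj₂ (sumOver-singleton v (λ _ → 1) , maximal)) , singleton-refl v
    where
    ⊆N⁺w : ∀ u → singleton v u ≡ true → Np G ord w u ≡ true
    ⊆N⁺w u u∈v = subst (λ u → Np G ord w u ≡ true) (sym (singleton⇒≡ u∈v)) v∈N⁺w
    maximal : ∀ u u' → singleton v u ≡ true → Np G ord w u' ≡ true → adj G u u' ≡ false
    maximal u u' u∈v u'∈N⁺w rewrite singleton⇒≡ {a = v} {u} u∈v =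
      subst (λ b → b ∧ adj G v u' ≡ false) u'∈N⁺w (¬anyFin⇒∀ _ any u')

module Leaders {n : ℕ} (G : Graph n) (ord : TotalOrder n) (U : Fin n → Bool)
  (x : Fin n → Fin n → Bool)
  (C1 : ∀ w → ¬ InS G ord w → 1 ≤ b2n (x w w) + sumOver (Nm G ord w) (λ u → b2n (x u w)))
  (C2 : ∀ w → ¬ InT G ord w → ¬ InS G ord w → ∀ K → InCalK G ord w K →
          sumOver K (λ u → b2n (x w u)) ≤ b2n (x w w))
  (C3 : ∀ w → ¬ InT G ord w → InS G ord w → ∀ K → InCalK G ord w K →
          sumOver K (λ u → b2n (x w u)) ≤ 1)
  where

  weightSupport : Fin n → Fin n → Bool
  weightSupport v u = (Nm G ord v u ∧ not (U u)) ∨ singleton v u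

  weight : Fin n → ℕ
  weight v = sumOver (weightSupport v) (λ u → b2n (x u v))

  Leader : Fin n → Bool
  Leader v = SU G ord U v ∨ (U v ∧ (0 <ᵇ weight v))

  Covers : Fin n → Fin n → Set
  Covers r v = Nm G ord v r ≡ true × x r v ≡ true

  self∈weightSupport : ∀ v → weightSupport v v ≡ true
  self∈weightSupport v = trans (cong (_ ∨_) (singleton-refl v)) (∨-zeroʳ _)

  covers⇒Np : ∀ {r v} → Covers r v → Np G ord r v ≡ true
  covers⇒Np {r} {v} (v∈N⁺r , _) = trans (Np≡Nm G ord r v) v∈N⁺r

  covers⇒¬InT : ∀ {r v} → Covers r v → ¬ InT G ord r
  covers⇒¬InT {v = v} r↦v r∈T = not-¬ (covers⇒Np r↦v) (r∈T v)

  sumOver-𝒦≤1 : ∀ {r K} → ¬ InT G ord r → InCalK G ord r K → sumOver K (λ u → b2n (x r u)) ≤ 1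
  sumOver-𝒦≤1 {r} {K} r∉T K∈𝒦 with InS? G ord r
  ... | yes r∈S = C3 r r∉T r∈S K K∈𝒦
  ... | no  r∉S = ≤-trans (C2 r r∉T r∉S K K∈𝒦) (b2n≤1 (x r r))

  covered⇒nonadjacent : ∀ {r u v} → Covers r u → Covers r v → adj G u v ≡ true → ⊥
  covered⇒nonadjacent {r} {u} {v} r↦u@(_ , xru) r↦v@(_ , xrv) uv = <-irrefl refl 2≤1
    where
    2≤1 : 2 ≤ 1
    2≤1 = subst (_≤ 1)
      (trans (sumOver-pair (adjacent⇒≢ G ord uv) (λ w → b2n (x r w)))
             (cong₂ (λ a b → b2n a + b2n b) xru xrv))
      (sumOver-𝒦≤1 (covers⇒¬InT r↦u) (pair∈𝒦 G ord uv (covers⇒Np r↦u) (covers⇒Np r↦v)))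

  coverer-is-Leader : ∀ {r v} → U r ≡ true → Covers r v → Leader r ≡ true
  coverer-is-Leader {r} {v} r∈U r↦v@(_ , xrv) with SU G ord U r in r∈SU?
  ... | true  = refl
  ... | false = cong₂ _∧_ r∈U (0<ᵇ 1≤weight)
    where
    0<ᵇ : ∀ {m} → 1 ≤ m → (0 <ᵇ m) ≡ true
    0<ᵇ (s≤s _) = refl
    1≤xrr : 1 ≤ b2n (x r r)
    1≤xrr with K , K∈𝒦 , v∈K ← ∃𝒦∋ G ord (covers⇒Np r↦v) = begin
      1                              ≡⟨ cong b2n (sym xrv) ⟩
      b2n (x r v)                    ≤⟨ member≤sumOver K (λ u → b2n (x r u)) v∈K ⟩
      sumOver K (λ u → b2n (x r u))  ≤⟨ C2 r (covers⇒¬InT r↦v) (¬SU⇒¬InS G ord U r∈U r∈SU?) K K∈𝒦 ⟩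
      b2n (x r r)                    ∎
      where open ≤-Reasoning
    1≤weight : 1 ≤ weight r
    1≤weight = ≤-trans 1≤xrr (member≤sumOver (weightSupport r) _ (self∈weightSupport r))

  weightless-is-covered : ∀ {v} → U v ≡ true → SU G ord U v ≡ false → weight v ≡ 0 →
    ∃ λ r → U r ≡ true × Covers r v
  weightless-is-covered {v} v∈U v∉SU w≡0 = covered (0<sumOver⇒∃ (Nm G ord v) x∙v 0<Σ)
    where
    x∙v : Fin n → ℕ
    x∙v u = b2n (x u v)
    off : ∀ {u} → weightSupport v u ≡ true → x∙v u ≡ 0
    off u∈W = n≤0⇒n≡0 (subst (_ ≤_) w≡0 (member≤sumOver (weightSupport v) x∙v u∈W))
    0<Σ : 0 < sumOver (Nm G ord v) x∙v
    0<Σ = subst (λ m → 1 ≤ m + sumOver (Nm G ord v) x∙v) (off (self∈weightSupport v))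
                (C1 v (¬SU⇒¬InS G ord U v∈U v∉SU))
    covered : (∃ λ u → Nm G ord v u ≡ true × 0 < x∙v u) → ∃ λ r → U r ≡ true × Covers r v
    covered (u , u∈N⁻v , 0<xuv) with U u in u∈U?
    ... | true  = u , u∈U? , u∈N⁻v , 0<b2n⇒≡true 0<xuv
    ... | false = contradiction (subst (0 <_) (off u∈W) 0<xuv) λ ()
      where u∈W = cong₂ (λ a b → (a ∧ not b) ∨ singleton v u) u∈N⁻v u∈U?

  non-Leader⇒weightless : ∀ {v} → U v ≡ true → Leader v ≡ false →
    SU G ord U v ≡ false × weight v ≡ 0
  non-Leader⇒weightless {v} v∈U ¬leader =
    let (v∉SU , ¬w>0) = split (SU G ord U v) (U v) (0 <ᵇ weight v) ¬leader v∈U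
    in v∉SU , ≯0 ¬w>0
    where
    split : ∀ s u b → s ∨ (u ∧ b) ≡ false → u ≡ true → s ≡ false × b ≡ false
    split false true false _ _ = refl , refl
    ≯0 : ∀ {m} → (0 <ᵇ m) ≡ false → m ≡ 0
    ≯0 {zero} _ = refl

  representative : ∀ {v} → U v ≡ true → ∃ λ r → Leader r ≡ true × (r ≡ v ⊎ Covers r v)
  representative {v} v∈U with Leader v in leader?
  ... | true  = v , leader? , inj₁ refl
  ... | false =
    let (v∉SU , w≡0)    = non-Leader⇒weightless v∈U leader?
        (r , r∈U , r↦v) = weightless-is-covered v∈U v∉SU w≡0
    in r , coverer-is-Leader r∈U r↦v , inj₂ r↦v

  common-representative⇒nonadjacent : ∀ {r u v} → r ≡ u ⊎ Covers r u → r ≡ v ⊎ Covers r v →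
    adj G u v ≡ false
  common-representative⇒nonadjacent (inj₁ refl) (inj₁ refl) = Graph.irrefl G _
  common-representative⇒nonadjacent (inj₁ refl) (inj₂ r↦v)  = Nm⇒nonadjacent G ord (proj₁ r↦v)
  common-representative⇒nonadjacent {u = u} {v} (inj₂ r↦u) (inj₁ refl) =
    trans (Graph.sym G u v) (Nm⇒nonadjacent G ord (proj₁ r↦u))
  common-representative⇒nonadjacent {u = u} {v} (inj₂ r↦u) (inj₂ r↦v) with adj G u v in uv
  ... | true  = contradiction (covered⇒nonadjacent r↦u r↦v uv) λ ()
  ... | false = refl

  Leaders-colouring : Colorable G U (card Leader)
  Leaders-colouring = colorable-by-representatives G U Leader
    (λ v v∈U → proj₁ (representative v∈U))
    (λ v v∈U → proj₁ (proj₂ (representative v∈U)))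
    (λ u v u∈U v∈U uv ρu≡ρv → not-¬ uv (common-representative⇒nonadjacent
       (proj₂ (proj₂ (representative u∈U)))
       (subst (λ r → r ≡ v ⊎ Covers r v) (sym ρu≡ρv) (proj₂ (proj₂ (representative v∈U))))))

  card-Leader≤ : card Leader ≤ lhs G ord U x + card (SU G ord U)
  card-Leader≤ = ≤-trans (sumFin-mono (λ v → counted (SU G ord U v) (U v) (weight v)))
    (≤-reflexive (sumFin-+ (λ v → if U v ∧ not (SU G ord U v) then weight v else 0)
                           (λ v → if SU G ord U v then 1 else 0)))
    where
    counted : ∀ s u m → (if s ∨ (u ∧ (0 <ᵇ m)) then 1 else 0) ≤
                        (if u ∧ not s then m else 0) + (if s then 1 else 0)
    counted true  u     m       = m≤n+m 1 _
    counted false false m       = z≤n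
    counted false true  zero    = z≤n
    counted false true  (suc m) = s≤s z≤n

proposition3 : (n : ℕ) (G : Graph n) (p : Fin n → ℕ) → (∀ v → 0 < p v) →
    (ord : TotalOrder n) (U : Fin n → Bool) →
    (y : ℚ) (x : Fin n → Fin n → Bool) → 0ℚ ≤ℚ y → Feasible G ord p y x →
    (χ : ℕ) → IsChromaticNumber G U χ →
    χ ≤ lhs G ord U x + card (SU G ord U)
proposition3 _ G _ _ ord U _ x _ (C1 , C2 , C3 , _) _ (_ , χ-least) =
  ≤-trans (χ-least (card Leader) Leaders-colouring) card-Leader≤
  where open Leaders G ord U x C1 C2 C3
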